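{- Let $w,y\in S_n$ and $A,B\subset\Box$. Suppose that $\mathrm{rk}_y(p)=\mathrm{rk}_w(p)$ for all $p\in A$ and $\mathrm{rk}_y(p)\ge\mathrm{rk}_w(p)$ for all $p\in B$. Then $\mathrm{rk}_y\ge\mathrm{rk}_w$ on $C^w_A(B)$.
   Context: $S_n$ is the symmetric group on $\{1,\dots,n\}$ and $\Box=\{0,\dots,n\}\times\{0,\dots,n\}$. For $w\in S_n$ and $(i,j)\in\Box$, $\mathrm{rk}_w(i,j)=\#\{u\in\{1,\dots,i\}:w(u)\le j\}$. For $p=(i,j),p'=(i',j')\in\Box$ put $\mathrm{cr}(p,p')=\{(i,j'),(i',j)\}$ and $D_w(p,p')=\mathrm{rk}_w(p)+\mathrm{rk}_w(p')-\mathrm{rk}_w(i,j')-\mathrm{rk}_w(i',j)$. Write $p\bowtie p'$ if $(i'-i)(j'-j)>0$. For $A,B\subset\Box$ define $C^w_A(B)=B\cup\{p\in\Box:\exists p'\in A \text{ with } p\bowtie p',\ D_w(p,p')=0,\ \mathrm{cr}(p,p')\subset B\}$. -}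

module Defs where

open import Data.Nat using (ℕ; zero; suc; _≤_; _<_; _≤ᵇ_; _<ᵇ_)
open import Data.Bool using (Bool; true; false; _∧_; if_then_else_)
open import Data.Fin using (Fin; toℕ)
open import Data.Fin.Permutation using (Permutation′; _⟨$⟩ʳ_)
open import Data.List using (List; length; filter; map)
open import Data.List using () renaming (allFin to allFinL)
open import Data.Vec using (toList; allFin)
open import Data.Integer as ℤ using (ℤ; +_; _-_; _*_; 0ℤ)
open import Data.Product using (_×_; _,_; ∃; Σ)
open import Data.Sum using (_⊎_)
open import Relation.Binary.PropositionalEquality using (_≡_)
open import Relation.Nullary using (Dec)
open import Relation.Nullary.Decidable using (⌊_⌋)

-- S_n : permutations of Fin n; the element u ∈ Fin n stands for u+1 ∈ {1,…,n}.
Perm : ℕ → Set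
Perm n = Permutation′ n

-- The box {0,…,n} × {0,…,n}, coordinates as Fin (suc n) (value = toℕ).
Pt : ℕ → Set
Pt n = Fin (suc n) × Fin (suc n)

Subset : ℕ → Set₁
Subset n = Pt n → Set

-- rk_w(i,j) = #{u ∈ {1,…,i} : w(u) ≤ j}.
-- With u = 1 + toℕ k (k : Fin n), u ≤ i iff toℕ k < i, and w(u) ≤ j iff toℕ (w k) < j.
rkℕ : ∀ {n} → Perm n → ℕ → ℕ → ℕ
rkℕ {n} w i j =
  length (filter (λ k → Data.Nat._<?_ (toℕ k) i Relation.Nullary.×-dec
                        Data.Nat._<?_ (toℕ (w ⟨$⟩ʳ k)) j)
                 (toList (allFin n)))

rk : ∀ {n} → Perm n → Pt n → ℕ
rk w (i , j) = rkℕ w (toℕ i) (toℕ j)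

-- cr(p,p') = {(i,j'),(i',j)}
-- D_w(p,p') = rk(p) + rk(p') - rk(i,j') - rk(i',j), in ℤ.
D : ∀ {n} → Perm n → Pt n → Pt n → ℤ
D w (i , j) (i′ , j′) =
  ((+ rk w (i , j)) ℤ.+ (+ rk w (i′ , j′))) - (+ rk w (i , j′)) - (+ rk w (i′ , j))

_⋈_ : ∀ {n} → Pt n → Pt n → Set
(i , j) ⋈ (i′ , j′) = 0ℤ ℤ.< ((+ toℕ i′) - (+ toℕ i)) * ((+ toℕ j′) - (+ toℕ j))

C : ∀ {n} → Perm n → Subset n → Subset n → Subset n
C w A B p = B p ⊎ ∃ λ p′ → A p′ × (p ⋈ p′) × (D w p p′ ≡ 0ℤ)
                   × (B (Data.Product.proj₁ p , Data.Product.proj₂ p′)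
                      × B (Data.Product.proj₁ p′ , Data.Product.proj₂ p))

module Submission where

-- The rank function of a permutation counts the points
-- (u, w(u)) of its graph lying in a lower-left quadrant, and any such
-- quadrant count is supermodular: for i ≤ i' and j ≤ j',
--     rk(i,j') + rk(i',j) ≤ rk(i,j) + rk(i',j'),
-- because this already holds point by point for the indicator functions.
-- Now let p ∈ C^w_A(B) come from p' ∈ A with p ⋈ p', D_w(p,p') = 0 and
-- cr(p,p') ⊂ B.  Then
--     rk_w p + rk_y p' = rk_w p + rk_w p'       (p' ∈ A)
--                      = rk_w cr(p,p')           (D_w(p,p') = 0)
--                      ≤ rk_y cr(p,p')           (cr(p,p') ⊂ B)
--                      ≤ rk_y p + rk_y p'        (supermodularity of rk_y),
-- and cancelling rk_y p' gives rk_w p ≤ rk_y p.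
-- The file proves supermodularity of quadrant counts for an arbitrary list
-- of points, then translates ⋈ and D_w = 0 into statements about ℕ, and
-- finally assembles the chain above.

open import Defs
open import Data.Nat using (ℕ; _≤_)
open import Relation.Binary.PropositionalEquality using (_≡_)

open import Data.Nat using (_+_; _<_; _<?_; z≤n)
open import Data.Nat.Properties
  using (≤-refl; ≤-trans; ≤-total; +-mono-≤; +-comm; +-cancelʳ-≤; +-commutativeSemigroup; module ≤-Reasoning)
open import Algebra.Properties.CommutativeSemigroup +-commutativeSemigroup using (interchange)
open import Data.Integer as ℤ using (+_; 0ℤ; _-_; _*_)
import Data.Integer.Properties as ℤP
open import Data.Bool using (Bool; true; false; _∧_; f≤t; b≤b) renaming (_≤_ to _≤ᵇ_)
open import Data.Fin using (toℕ)
open import Data.Fin.Permutation using (_⟨$⟩ʳ_)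
open import Data.List using (List; []; _∷_; length; filter)
open import Data.Vec using (toList; allFin)
open import Data.Product using (_×_; _,_)
open import Data.Sum using (_⊎_; inj₁; inj₂)
open import Data.Empty using (⊥-elim)
open import Relation.Nullary using (Dec; yes; no; does; _×-dec_)
open import Level using (0ℓ)
open import Relation.Unary using (Pred; Decidable)
open import Relation.Binary.PropositionalEquality using (refl; cong; cong₂; module ≡-Reasoning)
open import Data.Integer.Tactic.RingSolver using (solve-∀)

[_] : Bool → ℕ
[ true ]  = 1
[ false ] = 0

length-filter-∷ : ∀ {X : Set} {P : Pred X 0ℓ} (P? : Decidable P) x xs →
  length (filter P? (x ∷ xs)) ≡ [ does (P? x) ] + length (filter P? xs)
length-filter-∷ P? x xs with does (P? x)
... | true  = refl
... | false = refl

-- Supermodularity of ∧ for monotone tests: if a ≤ a' and b ≤ b' then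
-- [a ∧ b'] + [a' ∧ b] ≤ [a ∧ b] + [a' ∧ b'].  This is the pointwise form
-- of the quadrangle inequality for quadrant counts.
∧-supermodular : ∀ {a a' b b'} → a ≤ᵇ a' → b ≤ᵇ b' →
  [ a ∧ b' ] + [ a' ∧ b ] ≤ [ a ∧ b ] + [ a' ∧ b' ]
∧-supermodular b≤b b≤b = ≤-refl
∧-supermodular {true}  b≤b f≤t = ≤-refl
∧-supermodular {false} b≤b f≤t = ≤-refl
∧-supermodular {b = true}  f≤t b≤b = ≤-refl
∧-supermodular {b = false} f≤t b≤b = ≤-refl
∧-supermodular f≤t f≤t = z≤n

does-monotone : ∀ {P Q : Set} (P? : Dec P) (Q? : Dec Q) → (P → Q) → does P? ≤ᵇ does Q?
does-monotone (yes _) (yes _) _   = b≤b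
does-monotone (no _)  (yes _) _   = f≤t
does-monotone (no _)  (no _)  _   = b≤b
does-monotone (yes p) (no ¬q) p⇒q = ⊥-elim (¬q (p⇒q p))

-- Counting the points (f x, g x), x ∈ xs, that lie in the open quadrant
-- [0,i) × [0,j); the rank function of a permutation is such a count.
module QuadrantCount {X : Set} (f g : X → ℕ) where

  inQuadrant? : ∀ i j → Decidable (λ x → f x < i × g x < j)
  inQuadrant? i j x = (f x <? i) ×-dec (g x <? j)

  count : ℕ → ℕ → List X → ℕ
  count i j xs = length (filter (inQuadrant? i j) xs)

  count-supermodular : ∀ {i i' j j'} → i ≤ i' → j ≤ j' → ∀ xs →
    count i j' xs + count i' j xs ≤ count i j xs + count i' j' xs
  count-supermodular i≤i' j≤j' [] = z≤n
  count-supermodular {i} {i'} {j} {j'} i≤i' j≤j' (x ∷ xs) = begin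
    count i j' (x ∷ xs) + count i' j (x ∷ xs)
      ≡⟨ cong₂ _+_ (length-filter-∷ (inQuadrant? i j') x xs) (length-filter-∷ (inQuadrant? i' j) x xs) ⟩
    ([ a ∧ b' ] + count i j' xs) + ([ a' ∧ b ] + count i' j xs)
      ≡⟨ interchange [ a ∧ b' ] _ [ a' ∧ b ] _ ⟩
    ([ a ∧ b' ] + [ a' ∧ b ]) + (count i j' xs + count i' j xs)
      ≤⟨ +-mono-≤ (∧-supermodular (does-monotone (f x <? i) (f x <? i') (λ fx<i → ≤-trans fx<i i≤i'))
                                  (does-monotone (g x <? j) (g x <? j') (λ gx<j → ≤-trans gx<j j≤j')))
                  (count-supermodular i≤i' j≤j' xs) ⟩
    ([ a ∧ b ] + [ a' ∧ b' ]) + (count i j xs + count i' j' xs)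
      ≡⟨ interchange [ a ∧ b ] _ [ a' ∧ b' ] _ ⟨
    ([ a ∧ b ] + count i j xs) + ([ a' ∧ b' ] + count i' j' xs)
      ≡⟨ cong₂ _+_ (length-filter-∷ (inQuadrant? i j) x xs) (length-filter-∷ (inQuadrant? i' j') x xs) ⟨
    count i j (x ∷ xs) + count i' j' (x ∷ xs) ∎
    where
    open ≤-Reasoning
    a  = does (f x <? i)
    a' = does (f x <? i')
    b  = does (g x <? j)
    b' = does (g x <? j')

open QuadrantCount using (count; count-supermodular)

nonNeg*nonPos≤0 : ∀ a b → 0ℤ ℤ.≤ a → b ℤ.≤ 0ℤ → a * b ℤ.≤ 0ℤ
nonNeg*nonPos≤0 (+ k) b _ b≤0 =
  ℤP.≤-trans (ℤP.*-monoˡ-≤-nonNeg (+ k) b≤0) (ℤP.≤-reflexive (ℤP.*-zeroʳ (+ k)))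

comparable-if-product-positive : ∀ i i' j j' →
  0ℤ ℤ.< ((+ i') - (+ i)) * ((+ j') - (+ j)) →
  (i ≤ i' × j ≤ j') ⊎ (i' ≤ i × j' ≤ j)
comparable-if-product-positive i i' j j' pos with ≤-total i i' | ≤-total j j'
... | inj₁ i≤i' | inj₁ j≤j' = inj₁ (i≤i' , j≤j')
... | inj₂ i'≤i | inj₂ j'≤j = inj₂ (i'≤i , j'≤j)
... | inj₁ i≤i' | inj₂ j'≤j = ⊥-elim (ℤP.<⇒≱ pos
      (nonNeg*nonPos≤0 _ _ (ℤP.i≤j⇒0≤j-i (ℤ.+≤+ i≤i')) (ℤP.i≤j⇒i-j≤0 (ℤ.+≤+ j'≤j))))
... | inj₂ i'≤i | inj₁ j≤j' = ⊥-elim (ℤP.<⇒≱ pos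
      (ℤP.≤-trans (ℤP.≤-reflexive (ℤP.*-comm ((+ i') - (+ i)) ((+ j') - (+ j))))
        (nonNeg*nonPos≤0 _ _ (ℤP.i≤j⇒0≤j-i (ℤ.+≤+ j≤j')) (ℤP.i≤j⇒i-j≤0 (ℤ.+≤+ i'≤i)))))

-- Here rk w is, by
-- definition, the quadrant count of the graph {(k, w k)} of w.
rk-supermodular : ∀ {n} (w : Perm n) i j i' j' → (i , j) ⋈ (i' , j') →
  rk w (i , j') + rk w (i' , j) ≤ rk w (i , j) + rk w (i' , j')
rk-supermodular {n} w i j i' j' p⋈p'
  with comparable-if-product-positive (toℕ i) (toℕ i') (toℕ j) (toℕ j') p⋈p'
... | inj₁ (i≤i' , j≤j') = count-supermodular toℕ (λ k → toℕ (w ⟨$⟩ʳ k)) i≤i' j≤j' (toList (allFin n))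
... | inj₂ (i'≤i , j'≤j) = begin
  rk w (i , j') + rk w (i' , j)  ≡⟨ +-comm (rk w (i , j')) _ ⟩
  rk w (i' , j) + rk w (i , j')  ≤⟨ count-supermodular toℕ (λ k → toℕ (w ⟨$⟩ʳ k)) i'≤i j'≤j (toList (allFin n)) ⟩
  rk w (i' , j') + rk w (i , j)  ≡⟨ +-comm (rk w (i' , j')) _ ⟩
  rk w (i , j) + rk w (i' , j')  ∎
  where open ≤-Reasoning

balanced-if-difference-zero : ∀ a b c d →
  ((+ a) ℤ.+ (+ b)) - (+ c) - (+ d) ≡ 0ℤ → a + b ≡ c + d
balanced-if-difference-zero a b c d diff≡0 = ℤP.+-injective (begin
  + (a + b)
    ≡⟨ ℤP.pos-+ a b ⟩
  (+ a) ℤ.+ (+ b)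
    ≡⟨ regroup (+ a) (+ b) (+ c) (+ d) ⟩
  ((+ a) ℤ.+ (+ b) - (+ c) - (+ d)) ℤ.+ ((+ c) ℤ.+ (+ d))
    ≡⟨ cong (ℤ._+ ((+ c) ℤ.+ (+ d))) diff≡0 ⟩
  0ℤ ℤ.+ ((+ c) ℤ.+ (+ d))
    ≡⟨ ℤP.+-identityˡ _ ⟩
  (+ c) ℤ.+ (+ d)
    ≡⟨ ℤP.pos-+ c d ⟨
  + (c + d) ∎)
  where
  open ≡-Reasoning
  regroup : ∀ x y z t → x ℤ.+ y ≡ (x ℤ.+ y - z - t) ℤ.+ (z ℤ.+ t)
  regroup = solve-∀

D-zero-balance : ∀ {n} (w : Perm n) i j i' j' → D w (i , j) (i' , j') ≡ 0ℤ →
  rk w (i , j) + rk w (i' , j') ≡ rk w (i , j') + rk w (i' , j)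
D-zero-balance w i j i' j' =
  balanced-if-difference-zero (rk w (i , j)) (rk w (i' , j')) (rk w (i , j')) (rk w (i' , j))

lemma2p5 : ∀ {n} (w y : Perm n) (A B : Subset n) →
    (∀ p → A p → rk y p ≡ rk w p) →
    (∀ p → B p → rk w p ≤ rk y p) →
    ∀ p → C w A B p → rk w p ≤ rk y p
lemma2p5 w y A B onA onB p (inj₁ p∈B) = onB p p∈B
lemma2p5 w y A B onA onB (i , j) (inj₂ ((i' , j') , p'∈A , p⋈p' , D≡0 , cr₁∈B , cr₂∈B)) =
  +-cancelʳ-≤ (rk y (i' , j')) (rk w (i , j)) (rk y (i , j)) (begin
    rk w (i , j) + rk y (i' , j')    ≡⟨ cong (λ r → rk w (i , j) + r) (onA (i' , j') p'∈A) ⟩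
    rk w (i , j) + rk w (i' , j')    ≡⟨ D-zero-balance w i j i' j' D≡0 ⟩
    rk w (i , j') + rk w (i' , j)    ≤⟨ +-mono-≤ (onB (i , j') cr₁∈B) (onB (i' , j) cr₂∈B) ⟩
    rk y (i , j') + rk y (i' , j)    ≤⟨ rk-supermodular y i j i' j' p⋈p' ⟩
    rk y (i , j) + rk y (i' , j')    ∎)
  where open ≤-Reasoning
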